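{- Let $H_0$ be a 3-symmetric graph with at least one vertex, and let $G_1,G_2,\dots$ be 3-symmetric graphs with $|V(G_i)|\to\infty$. Then for every graph $S$ on $3$ vertices, $t(S,\operatorname{inflate}(G_i,H_0))\to p_S$ as $i\to\infty$, where $p_{K_3}=p_{\overline{K_3}}=1/8$ and $p_{P_3}=p_{\overline{P_3}}=3/8$ (these are the probabilities that a uniformly random graph on 3 labelled vertices, each edge present independently with probability $1/2$, is isomorphic to $S$).
   Context: All graphs are finite simple graphs. For a graph $S$ on $k$ vertices and a graph $G$ on $n$ vertices, $t(S,G)$ is the number of $k$-element vertex subsets of $G$ inducing a subgraph isomorphic to $S$, divided by $\binom{n}{k}$ (and $0$ if $n<k$). $K_3$ is the triangle, $\overline{K_3}$ the graph on 3 vertices with no edges, $P_3$ the path with 3 vertices (2 edges), $\overline{P_3}$ the graph on 3 vertices with exactly one edge. A graph $G$ is 3-symmetric if it has fewer than 3 vertices, or it has at least 3 vertices and $t(K_3,G)=t(\overline{K_3},G)=1/8$, $t(P_3,G)=t(\overline{P_3},G)=3/8$. For graphs $G,H$, the inflation $\operatorname{inflate}(G,H)$ is the graph with vertex set $V(G)\times V(H)$ in which $(u,a)$ and $(v,b)$ are adjacent iff either $u=v$ and $ab\in E(H)$, or $uv\in E(G)$ (i.e. each vertex of $G$ is replaced by a copy of $H$, and copies corresponding to adjacent vertices of $G$ are completely joined). -}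

module Defs where

open import Data.Bool using (Bool; true; false; _∧_; _∨_; not; if_then_else_)
open import Data.Nat as ℕ using (ℕ; zero; suc; _<ᵇ_)
open import Data.Nat.Combinatorics using (_C_)
open import Data.Fin as Fin using (Fin; toℕ; remQuot)
open import Data.Fin.Properties using (_≟_)
open import Data.List using (List; []; _∷_; length; filter; concatMap; allFin; map)
open import Data.Bool.ListAction using (and; any)
open import Data.Product using (_×_; _,_; proj₁; proj₂; ∃-syntax)
open import Data.Sum using (_⊎_)
open import Data.Integer using (+_)
open import Data.Rational as ℚ using (ℚ; 0ℚ; _/_; ∣_∣; _-_)
open import Relation.Binary.PropositionalEquality using (_≡_)
open import Relation.Nullary.Decidable using (⌊_⌋)
open import Data.Bool.Properties using () renaming (_≟_ to _≟ᵇ_)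

Graph : ℕ → Set
Graph n = Fin n → Fin n → Bool

record IsSimple {n : ℕ} (G : Graph n) : Set where
  field
    sym    : ∀ i j → G i j ≡ G j i
    irrefl : ∀ i → G i i ≡ false

beq : Bool → Bool → Bool
beq a b = ⌊ a ≟ᵇ b ⌋

z₀ z₁ z₂ : Fin 3
z₀ = Fin.zero
z₁ = Fin.suc Fin.zero
z₂ = Fin.suc (Fin.suc Fin.zero)

mkPerm : Fin 3 → Fin 3 → Fin 3 → (Fin 3 → Fin 3)
mkPerm a b c Fin.zero = a
mkPerm a b c (Fin.suc Fin.zero) = b
mkPerm a b c (Fin.suc (Fin.suc Fin.zero)) = c

perms3 : List (Fin 3 → Fin 3)
perms3 = mkPerm z₀ z₁ z₂ ∷ mkPerm z₀ z₂ z₁ ∷ mkPerm z₁ z₀ z₂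
       ∷ mkPerm z₁ z₂ z₀ ∷ mkPerm z₂ z₀ z₁ ∷ mkPerm z₂ z₁ z₀ ∷ []

iso3 : Graph 3 → Graph 3 → Bool
iso3 S T = any (λ σ → and (concatMap (λ i → map (λ j → beq (S i j) (T (σ i) (σ j))) (allFin 3)) (allFin 3))) perms3

-- 3-element subsets of Fin n, listed as increasing triples a < b < c
triples : (n : ℕ) → List (Fin n × Fin n × Fin n)
triples n = concatMap (λ a → concatMap (λ b → concatMap (λ c →
              if (toℕ a <ᵇ toℕ b) ∧ (toℕ b <ᵇ toℕ c) then (a , b , c) ∷ [] else [])
              (allFin n)) (allFin n)) (allFin n)

induced : {n : ℕ} → Graph n → Fin n × Fin n × Fin n → Graph 3
induced G (a , b , c) i j = G (mkPerm' i) (mkPerm' j)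
  where
  mkPerm' : Fin 3 → _
  mkPerm' Fin.zero = a
  mkPerm' (Fin.suc Fin.zero) = b
  mkPerm' (Fin.suc (Fin.suc Fin.zero)) = c

-- a / d, with the convention 0 when d = 0
frac : ℕ → ℕ → ℚ
frac a zero = 0ℚ
frac a (suc d) = (+ a) / suc d

t : Graph 3 → {n : ℕ} → Graph n → ℚ
t S {n} G = frac (length (filter (λ x → iso3 (induced G x) S ≟ᵇ true) (triples n))) (n C 3)

K3 coK3 P3 coP3 : Graph 3
K3 i j = not ⌊ i ≟ j ⌋
coK3 i j = false
P3 i j = not ⌊ i ≟ j ⌋ ∧ (⌊ i ≟ z₁ ⌋ ∨ ⌊ j ≟ z₁ ⌋)
coP3 i j = not ⌊ i ≟ j ⌋ ∧ not ⌊ i ≟ z₂ ⌋ ∧ not ⌊ j ≟ z₂ ⌋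

oneEighth threeEighths : ℚ
oneEighth = (+ 1) / 8
threeEighths = (+ 3) / 8

ThreeSymmetric : {n : ℕ} → Graph n → Set
ThreeSymmetric {n} G =
  n ℕ.< 3 ⊎ (t K3 G ≡ oneEighth × t coK3 G ≡ oneEighth
              × t P3 G ≡ threeEighths × t coP3 G ≡ threeEighths)

-- Inflation: vertex (u,a) ∈ Fin n × Fin m is encoded as Fin (n * m)
-- via the stdlib bijection remQuot.

inflate : {n m : ℕ} → Graph n → Graph m → Graph (n ℕ.* m)
inflate {n} {m} G H x y with remQuot m x | remQuot m y
... | (u , a) | (v , b) = (⌊ u ≟ v ⌋ ∧ H a b) ∨ G u v

-- p_S: probability that G(3,1/2) on labelled vertices Fin 3 is ≅ S.
-- The 8 labelled graphs on Fin 3 are indexed by edge indicators e01 e02 e12.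

labelled : Bool → Bool → Bool → Graph 3
labelled e01 e02 e12 i j = pick i j
  where
  pick : Fin 3 → Fin 3 → Bool
  pick Fin.zero (Fin.suc Fin.zero) = e01
  pick (Fin.suc Fin.zero) Fin.zero = e01
  pick Fin.zero (Fin.suc (Fin.suc Fin.zero)) = e02
  pick (Fin.suc (Fin.suc Fin.zero)) Fin.zero = e02
  pick (Fin.suc Fin.zero) (Fin.suc (Fin.suc Fin.zero)) = e12
  pick (Fin.suc (Fin.suc Fin.zero)) (Fin.suc Fin.zero) = e12
  pick _ _ = false

bools : List Bool
bools = true ∷ false ∷ []

pS : Graph 3 → ℚ
pS S = frac (length (filter (λ T → iso3 T S ≟ᵇ true)
         (concatMap (λ a → concatMap (λ b → map (λ c → labelled a b c) bools) bools) bools))) 8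

ConvergesTo : (ℕ → ℚ) → ℚ → Set
ConvergesTo x p = ∀ (ε : ℚ) → 0ℚ ℚ.< ε → ∃[ N ] (∀ i → N ℕ.≤ i → ∣ x i - p ∣ ℚ.< ε)

TendsToInfinity : (ℕ → ℕ) → Set
TendsToInfinity f = ∀ (M : ℕ) → ∃[ N ] (∀ i → N ℕ.≤ i → M ℕ.≤ f i)

module Submission where

-- The vertices of inflate G H₀ are the pairs (u , a), indexed by combine u a.  A triple of
-- them whose G-coordinates are distinct induces, H₀ being loopless, exactly the subgraph
-- that G induces on these coordinates.  This accounts for m³ (n choose 3) of the
-- (nm choose 3) triples; every other increasing triple has two equal G-coordinates, and
-- there are at most 2m³n² of those.  Hence t(S, inflate G H₀) and t(S, G) differ by at
-- most 2n² / (n choose 3) = O(1/n).  Finally t(S, G) = p_S for 3-symmetric G, because a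
-- simple graph on three vertices is determined up to isomorphism by its number of edges.

open import Defs
open import Data.Nat using (ℕ; _≤_; _*_; zero; suc; _+_; _∸_; _<_; _<ᵇ_; z≤n; z<s; >-nonZero)
open import Data.Nat.Properties
open import Data.Nat.Combinatorics using (_C_; nC1≡n; nCk+nC[k+1]≡[n+1]C[k+1])
open import Data.Nat.Tactic.RingSolver using (solve-∀)
open import Algebra.Properties.Semiring.Sum +-*-semiring
  using (sum-syntax; sum-cong-≗; sum-replicate-zero; ∑-distrib-+; ∑-comm; *-distribˡ-sum)
open import Data.Bool using (Bool; true; false; _∧_; _∨_; not; if_then_else_)
open import Data.Bool.Properties using (∧-zeroʳ; ∧-identityʳ; ∧-conicalˡ; ∧-conicalʳ; T-≡)
  renaming (_≟_ to _≟ᵇ_)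
open import Data.Bool.ListAction using (and; or)
open import Data.Fin using (Fin; toℕ; combine; _↑ˡ_; _↑ʳ_)
open import Data.Fin.Patterns using (0F; 1F; 2F)
open import Data.Fin.Properties using (remQuot-combine; combine-monoˡ-<; toℕ-injective)
  renaming (_≟_ to _≟ᶠ_; <⇒≢ to <⇒≢ᶠ)
open import Data.List using (List; []; _∷_; _++_; length; filter; map; concatMap; tabulate; allFin)
open import Data.List.Properties using (length-++; filter-++; filter-≐; map-cong; concatMap-cong)
open import Data.Integer as ℤ using (+[1+_]; -[1+_]; _⊖_)
import Data.Integer.Properties as ℤ
open import Data.Rational as ℚ using (ℚ; mkℚ)
import Data.Rational.Properties as ℚ
open import Data.Rational.Unnormalised as ℚᵘ using (mkℚᵘ)
import Data.Rational.Unnormalised.Properties as ℚᵘ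
open import Data.Product using (_×_; _,_; proj₁; proj₂)
open import Data.Sum using (_⊎_; inj₁; inj₂)
open import Data.Empty using (⊥-elim)
open import Function using (Equivalence; case_of_)
open import Relation.Nullary using (¬_; yes; no; does)
open import Relation.Nullary.Decidable using (Dec; toWitness; map′; _×-dec_; ⌊_⌋)
open import Relation.Binary.PropositionalEquality

∑-cong : ∀ {k} {f g : Fin k → ℕ} → (∀ i → f i ≡ g i) → ∑[ i < k ] f i ≡ ∑[ i < k ] g i
∑-cong = sum-cong-≗

∑-mono : ∀ {k} {f g : Fin k → ℕ} → (∀ i → f i ≤ g i) → ∑[ i < k ] f i ≤ ∑[ i < k ] g i
∑-mono {zero}  f≤g = z≤n
∑-mono {suc k} f≤g = +-mono-≤ (f≤g Fin.zero) (∑-mono (λ i → f≤g (Fin.suc i)))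

∑-const : ∀ k x → ∑[ i < k ] x ≡ k * x
∑-const zero    x = refl
∑-const (suc k) x = cong (x +_) (∑-const k x)

∑-*ˡ : ∀ {k} x (f : Fin k → ℕ) → ∑[ i < k ] (x * f i) ≡ x * ∑[ i < k ] f i
∑-*ˡ x f = sym (*-distribˡ-sum x f)

∑-↑ : ∀ m {k} (f : Fin (m + k) → ℕ) →
      ∑[ i < m + k ] f i ≡ ∑[ i < m ] f (i ↑ˡ k) + ∑[ j < k ] f (m ↑ʳ j)
∑-↑ zero    f = refl
∑-↑ (suc m) f = trans (cong (f Fin.zero +_) (∑-↑ m (λ i → f (Fin.suc i)))) (sym (+-assoc (f Fin.zero) _ _))

∑-combine : ∀ n {m} (f : Fin (n * m) → ℕ) → ∑[ x < n * m ] f x ≡ ∑[ u < n ] ∑[ a < m ] f (combine u a)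
∑-combine zero    f = refl
∑-combine (suc n) {m} f =
  trans (∑-↑ m f) (cong (∑[ a < m ] f (a ↑ˡ (n * m)) +_) (∑-combine n {m} (λ x → f (m ↑ʳ x))))

∑³ : ∀ k → (Fin k → Fin k → Fin k → ℕ) → ℕ
∑³ k f = ∑[ a < k ] ∑[ b < k ] ∑[ c < k ] f a b c

module _ {k : ℕ} where

  open ≡-Reasoning

  ∑³-cong : ∀ {f g : Fin k → Fin k → Fin k → ℕ} → (∀ a b c → f a b c ≡ g a b c) → ∑³ k f ≡ ∑³ k g
  ∑³-cong f≡g = ∑-cong λ a → ∑-cong λ b → ∑-cong λ c → f≡g a b c

  ∑³-mono : ∀ {f g : Fin k → Fin k → Fin k → ℕ} → (∀ a b c → f a b c ≤ g a b c) → ∑³ k f ≤ ∑³ k g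
  ∑³-mono f≤g = ∑-mono λ a → ∑-mono λ b → ∑-mono λ c → f≤g a b c

  ∑³-distrib-+ : ∀ (f g : Fin k → Fin k → Fin k → ℕ) →
                 ∑³ k (λ a b c → f a b c + g a b c) ≡ ∑³ k f + ∑³ k g
  ∑³-distrib-+ f g = begin
    ∑³ k (λ a b c → f a b c + g a b c)
      ≡⟨ ∑-cong {k} (λ a → ∑-cong {k} λ b → ∑-distrib-+ (f a b) (g a b)) ⟩
    ∑[ a < k ] ∑[ b < k ] (∑[ c < k ] f a b c + ∑[ c < k ] g a b c)
      ≡⟨ ∑-cong {k} (λ a → ∑-distrib-+ (λ b → ∑[ c < k ] f a b c) (λ b → ∑[ c < k ] g a b c)) ⟩
    ∑[ a < k ] (∑[ b < k ] ∑[ c < k ] f a b c + ∑[ b < k ] ∑[ c < k ] g a b c)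
      ≡⟨ ∑-distrib-+ (λ a → ∑[ b < k ] ∑[ c < k ] f a b c) (λ a → ∑[ b < k ] ∑[ c < k ] g a b c) ⟩
    ∑³ k f + ∑³ k g ∎

  ∑³-*ˡ : ∀ x (f : Fin k → Fin k → Fin k → ℕ) → ∑³ k (λ a b c → x * f a b c) ≡ x * ∑³ k f
  ∑³-*ˡ x f = begin
    ∑³ k (λ a b c → x * f a b c)                   ≡⟨ ∑-cong {k} (λ a → ∑-cong {k} λ b → ∑-*ˡ x (f a b)) ⟩
    ∑[ a < k ] ∑[ b < k ] (x * ∑[ c < k ] f a b c) ≡⟨ ∑-cong {k} (λ a → ∑-*ˡ x (λ b → ∑[ c < k ] f a b c)) ⟩
    ∑[ a < k ] (x * ∑[ b < k ] ∑[ c < k ] f a b c) ≡⟨ ∑-*ˡ x (λ a → ∑[ b < k ] ∑[ c < k ] f a b c) ⟩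
    x * ∑³ k f                                     ∎

  ∑³-const : ∀ x → ∑³ k (λ _ _ _ → x) ≡ k * k * k * x
  ∑³-const x = begin
    ∑³ k (λ _ _ _ → x)             ≡⟨ ∑-cong {k} (λ _ → ∑-cong {k} λ _ → ∑-const k x) ⟩
    ∑[ a < k ] ∑[ b < k ] (k * x)  ≡⟨ ∑-cong {k} (λ _ → ∑-const k (k * x)) ⟩
    ∑[ a < k ] (k * (k * x))       ≡⟨ ∑-const k (k * (k * x)) ⟩
    k * (k * (k * x))              ≡⟨ cube k x ⟩
    k * k * k * x                  ∎
    where
    cube : ∀ k x → k * (k * (k * x)) ≡ k * k * k * x
    cube = solve-∀

∑³-combine : ∀ n {m} (f : Fin (n * m) → Fin (n * m) → Fin (n * m) → ℕ) →
  ∑³ (n * m) f ≡ ∑³ n λ u v w → ∑³ m λ a b c → f (combine u a) (combine v b) (combine w c)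
∑³-combine n {m} f = begin
  ∑³ (n * m) f
    ≡⟨ ∑-combine n {m} (λ x → ∑[ y < n * m ] ∑[ z < n * m ] f x y z) ⟩
  ∑[ u < n ] ∑[ a < m ] ∑[ y < n * m ] ∑[ z < n * m ] f (combine u a) y z
    ≡⟨ ∑-cong {n} (λ u → ∑-cong {m} λ a → ∑-combine n {m} (λ y → ∑[ z < n * m ] f (combine u a) y z)) ⟩
  ∑[ u < n ] ∑[ a < m ] ∑[ v < n ] ∑[ b < m ] ∑[ z < n * m ] f (combine u a) (combine v b) z
    ≡⟨ ∑-cong {n} (λ u → ∑-cong {m} λ a → ∑-cong {n} λ v → ∑-cong {m} λ b →
         ∑-combine n {m} (f (combine u a) (combine v b))) ⟩
  ∑[ u < n ] ∑[ a < m ] ∑[ v < n ] ∑[ b < m ] ∑[ w < n ] ∑[ c < m ] F u a v b w c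
    ≡⟨ ∑-cong {n} (λ u → ∑-comm (λ a v → ∑[ b < m ] ∑[ w < n ] ∑[ c < m ] F u a v b w c)) ⟩
  ∑[ u < n ] ∑[ v < n ] ∑[ a < m ] ∑[ b < m ] ∑[ w < n ] ∑[ c < m ] F u a v b w c
    ≡⟨ ∑-cong {n} (λ u → ∑-cong {n} λ v → ∑-cong {m} λ a →
         ∑-comm (λ b w → ∑[ c < m ] F u a v b w c)) ⟩
  ∑[ u < n ] ∑[ v < n ] ∑[ a < m ] ∑[ w < n ] ∑[ b < m ] ∑[ c < m ] F u a v b w c
    ≡⟨ ∑-cong {n} (λ u → ∑-cong {n} λ v → ∑-comm (λ a w → ∑[ b < m ] ∑[ c < m ] F u a v b w c)) ⟩
  (∑³ n λ u v w → ∑³ m λ a b c → F u a v b w c) ∎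
  where
  open ≡-Reasoning
  F : Fin n → Fin m → Fin n → Fin m → Fin n → Fin m → ℕ
  F u a v b w c = f (combine u a) (combine v b) (combine w c)

∑³-∑³-const : ∀ n m (f : Fin n → Fin n → Fin n → ℕ) →
  (∑³ n λ u v w → ∑³ m λ _ _ _ → f u v w) ≡ m * m * m * ∑³ n f
∑³-∑³-const n m f =
  trans (∑³-cong {n} λ u v w → ∑³-const {m} (f u v w)) (∑³-*ˡ {n} (m * m * m) f)

𝟙 : Bool → ℕ
𝟙 true  = 1
𝟙 false = 0

𝟙-∧-≤ : ∀ x y → 𝟙 (x ∧ y) ≤ 𝟙 x
𝟙-∧-≤ false y     = z≤n
𝟙-∧-≤ true  false = z≤n
𝟙-∧-≤ true  true  = ≤-refl

𝟙-split : ∀ {U W} Q Q′ → (U ≡ true → W ≡ true) → (U ≡ true → Q ≡ Q′) →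
          𝟙 (W ∧ Q) ≡ 𝟙 (U ∧ Q′) + 𝟙 ((W ∧ not U) ∧ Q)
𝟙-split {true}      Q Q′ U⇒W U⇒Q≡Q′ rewrite U⇒W refl | U⇒Q≡Q′ refl = sym (+-identityʳ (𝟙 Q′))
𝟙-split {false} {W} Q Q′ _   _       = cong (λ x → 𝟙 (x ∧ Q)) (sym (∧-identityʳ W))

count : {A : Set} → (A → Bool) → List A → ℕ
count P xs = length (filter (λ x → P x ≟ᵇ true) xs)

module _ {A : Set} (P : A → Bool) where

  count-++ : ∀ xs ys → count P (xs ++ ys) ≡ count P xs + count P ys
  count-++ xs ys = trans (cong length (filter-++ (λ x → P x ≟ᵇ true) xs ys))
                         (length-++ (filter (λ x → P x ≟ᵇ true) xs))

  count-concatMap-tabulate : ∀ {B : Set} k (f : Fin k → B) (h : B → List A) →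
    count P (concatMap h (tabulate f)) ≡ ∑[ i < k ] count P (h (f i))
  count-concatMap-tabulate zero    f h = refl
  count-concatMap-tabulate (suc k) f h =
    trans (count-++ (h (f Fin.zero)) _)
          (cong (count P (h (f Fin.zero)) +_) (count-concatMap-tabulate k (λ i → f (Fin.suc i)) h))

  count-cong : ∀ {Q : A → Bool} → (∀ x → P x ≡ Q x) → ∀ xs → count P xs ≡ count Q xs
  count-cong {Q} P≗Q xs = cong length (filter-≐ (λ x → P x ≟ᵇ true) (λ x → Q x ≟ᵇ true)
    ((λ {x} Px → trans (sym (P≗Q x)) Px) , (λ {x} Qx → trans (P≗Q x) Qx)) xs)

  count-if : ∀ b x → count P (if b then x ∷ [] else []) ≡ 𝟙 (b ∧ P x)
  count-if false x = refl
  count-if true  x with P x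
  ... | true  = refl
  ... | false = refl

_≺_ : ∀ {k} → Fin k → Fin k → Bool
a ≺ b = toℕ a <ᵇ toℕ b

increasing : ∀ {k} → Fin k → Fin k → Fin k → Bool
increasing a b c = a ≺ b ∧ b ≺ c

#increasing : ∀ k → (Fin k → Fin k → Fin k → Bool) → ℕ
#increasing k P = ∑³ k λ a b c → 𝟙 (increasing a b c ∧ P a b c)

#increasing-≤-all : ∀ k P → #increasing k P ≤ #increasing k (λ _ _ _ → true)
#increasing-≤-all k P = ∑³-mono {k} λ a b c →
  subst (𝟙 (increasing a b c ∧ P a b c) ≤_) (cong 𝟙 (sym (∧-identityʳ (increasing a b c)))) (𝟙-∧-≤ _ _)

count-triples : ∀ k (P : Fin k × Fin k × Fin k → Bool) →
  count P (triples k) ≡ #increasing k (λ a b c → P (a , b , c))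
count-triples k P =
  trans (count-concatMap-tabulate P k (λ a → a) _)
    (∑-cong {k} λ a → trans (count-concatMap-tabulate P k (λ b → b) _)
    (∑-cong {k} λ b → trans (count-concatMap-tabulate P k (λ c → c) _)
    (∑-cong {k} λ c → count-if P (increasing a b c) (a , b , c))))

#increasing-pairs : ∀ k → ∑[ a < k ] ∑[ b < k ] 𝟙 (a ≺ b) ≡ k C 2
#increasing-pairs zero    = refl
#increasing-pairs (suc k) = begin
  ∑[ b < k ] 1 + ∑[ a < k ] ∑[ b < k ] 𝟙 (a ≺ b)
    ≡⟨ cong₂ _+_ (trans (∑-const k 1) (*-identityʳ k)) (#increasing-pairs k) ⟩
  k + k C 2     ≡⟨ cong (_+ k C 2) (nC1≡n k) ⟨
  k C 1 + k C 2 ≡⟨ nCk+nC[k+1]≡[n+1]C[k+1] k 1 ⟩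
  suc k C 2     ∎
  where open ≡-Reasoning

#increasing-triples : ∀ k → ∑³ k (λ a b c → 𝟙 (increasing a b c)) ≡ k C 3
#increasing-triples zero    = refl
#increasing-triples (suc k) = begin
  ∑³ (suc k) (λ a b c → 𝟙 (increasing a b c))
    ≡⟨ cong₂ _+_ (cong (_+ ∑[ b < k ] ∑[ c < k ] 𝟙 (b ≺ c)) none)
                 (∑-cong {k} λ a → cong₂ _+_ none (∑-cong {k} λ b →
                    cong (_+ ∑[ c < k ] 𝟙 (increasing a b c)) (cong 𝟙 (∧-zeroʳ (a ≺ b))))) ⟩
  ∑[ b < k ] ∑[ c < k ] 𝟙 (b ≺ c) + ∑³ k (λ a b c → 𝟙 (increasing a b c))
    ≡⟨ cong₂ _+_ (#increasing-pairs k) (#increasing-triples k) ⟩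
  k C 2 + k C 3
    ≡⟨ nCk+nC[k+1]≡[n+1]C[k+1] k 2 ⟩
  suc k C 3 ∎
  where
  open ≡-Reasoning
  none : ∑[ c < suc k ] 0 ≡ 0
  none = sum-replicate-zero (suc k)

#increasing-all : ∀ k → #increasing k (λ _ _ _ → true) ≡ k C 3
#increasing-all k =
  trans (∑³-cong {k} λ a b c → cong 𝟙 (∧-identityʳ (increasing a b c))) (#increasing-triples k)

t≡#increasing-ratio : ∀ {n} (G : Graph n) S →
  t S G ≡ frac (#increasing n λ a b c → iso3 (induced G (a , b , c)) S) (#increasing n λ _ _ _ → true)
t≡#increasing-ratio {n} G S =
  cong₂ frac (count-triples n λ x → iso3 (induced G x) S) (sym (#increasing-all n))

-- Densities in 3-symmetric graphs

iso3-cong : ∀ {X Y S S′ : Graph 3} → (∀ i j → X i j ≡ Y i j) → (∀ i j → S i j ≡ S′ i j) →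
            iso3 X S ≡ iso3 Y S′
iso3-cong X≗Y S≗S′ = cong or (map-cong (λ σ → cong and (concatMap-cong (λ i →
  map-cong (λ j → cong₂ beq (X≗Y i j) (S≗S′ (σ i) (σ j))) (allFin 3)) (allFin 3))) perms3)

iso3-congˡ : ∀ {X Y : Graph 3} S → (∀ i j → X i j ≡ Y i j) → iso3 X S ≡ iso3 Y S
iso3-congˡ S X≗Y = iso3-cong {S = S} X≗Y (λ _ _ → refl)

iso3-congʳ : ∀ X {S S′ : Graph 3} → (∀ i j → S i j ≡ S′ i j) → iso3 X S ≡ iso3 X S′
iso3-congʳ X S≗S′ = iso3-cong {X = X} (λ _ _ → refl) S≗S′

edges : Graph 3 → Graph 3
edges X = labelled (X 0F 1F) (X 0F 2F) (X 1F 2F)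

edges-simple : ∀ {X : Graph 3} → IsSimple X → ∀ i j → X i j ≡ edges X i j
edges-simple s 0F 0F = IsSimple.irrefl s 0F
edges-simple s 0F 1F = refl
edges-simple s 0F 2F = refl
edges-simple s 1F 0F = IsSimple.sym s 1F 0F
edges-simple s 1F 1F = IsSimple.irrefl s 1F
edges-simple s 1F 2F = refl
edges-simple s 2F 0F = IsSimple.sym s 2F 0F
edges-simple s 2F 1F = IsSimple.sym s 2F 1F
edges-simple s 2F 2F = IsSimple.irrefl s 2F

induced-simple : ∀ {n} {G : Graph n} → IsSimple G → ∀ x → IsSimple (induced G x)
induced-simple {G = G} s (a , b , c) = record { sym = symmetric ; irrefl = irreflexive }
  where
  open IsSimple s renaming (sym to symᴳ)
  symmetric : ∀ i j → induced G (a , b , c) i j ≡ induced G (a , b , c) j i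
  symmetric 0F 0F = refl
  symmetric 0F 1F = symᴳ a b
  symmetric 0F 2F = symᴳ a c
  symmetric 1F 0F = symᴳ b a
  symmetric 1F 1F = refl
  symmetric 1F 2F = symᴳ b c
  symmetric 2F 0F = symᴳ c a
  symmetric 2F 1F = symᴳ c b
  symmetric 2F 2F = refl
  irreflexive : ∀ i → induced G (a , b , c) i i ≡ false
  irreflexive 0F = irrefl a
  irreflexive 1F = irrefl b
  irreflexive 2F = irrefl c

representative : Bool → Bool → Bool → Graph 3
representative true  true  true  = K3
representative true  true  false = P3
representative true  false true  = P3
representative false true  true  = P3
representative true  false false = coP3
representative false true  false = coP3
representative false false true  = coP3
representative false false false = coK3

canonical : Graph 3 → Graph 3
canonical S = representative (S 0F 1F) (S 0F 2F) (S 1F 2F)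

∀ᵇ? : {P : Bool → Set} → (∀ b → Dec (P b)) → Dec (∀ b → P b)
∀ᵇ? P? = map′ (λ (pt , pf) → λ { true → pt ; false → pf }) (λ h → h true , h false) (P? true ×-dec P? false)

iso3-labelled-representative : ∀ x y z a b c →
  iso3 (labelled x y z) (labelled a b c) ≡ iso3 (labelled x y z) (representative a b c)
iso3-labelled-representative = toWitness {a? = ∀ᵇ? λ x → ∀ᵇ? λ y → ∀ᵇ? λ z → ∀ᵇ? λ a → ∀ᵇ? λ b → ∀ᵇ? λ c →
  iso3 (labelled x y z) (labelled a b c) ≟ᵇ iso3 (labelled x y z) (representative a b c)} _

pS-labelled-representative : ∀ a b c → pS (labelled a b c) ≡ pS (representative a b c)
pS-labelled-representative = toWitness {a? = ∀ᵇ? λ a → ∀ᵇ? λ b → ∀ᵇ? λ c →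
  pS (labelled a b c) ℚ.≟ pS (representative a b c)} _

iso3-canonical : ∀ {X S : Graph 3} → IsSimple X → IsSimple S → iso3 X S ≡ iso3 X (canonical S)
iso3-canonical {X} {S} sX sS = begin
  iso3 X S                     ≡⟨ iso3-cong (edges-simple sX) (edges-simple sS) ⟩
  iso3 (edges X) (edges S)     ≡⟨ iso3-labelled-representative (X 0F 1F) (X 0F 2F) (X 1F 2F)
                                                                (S 0F 1F) (S 0F 2F) (S 1F 2F) ⟩
  iso3 (edges X) (canonical S) ≡⟨ iso3-congˡ (canonical S) (edges-simple sX) ⟨
  iso3 X (canonical S)         ∎
  where open ≡-Reasoning

t-canonical : ∀ {n} {G : Graph n} {S : Graph 3} → IsSimple G → IsSimple S → t S G ≡ t (canonical S) G
t-canonical {n} sG sS =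
  cong (λ k → frac k (n C 3)) (count-cong _ (λ x → iso3-canonical (induced-simple sG x) sS) (triples n))

pS-canonical : ∀ {S : Graph 3} → IsSimple S → pS S ≡ pS (canonical S)
pS-canonical {S} sS = trans
  (cong (λ k → frac k 8) (count-cong (λ T → iso3 T S) {λ T → iso3 T (edges S)}
    (λ T → iso3-congʳ T (edges-simple sS))
    (concatMap (λ a → concatMap (λ b → map (λ c → labelled a b c) bools) bools) bools)))
  (pS-labelled-representative (S 0F 1F) (S 0F 2F) (S 1F 2F))

t≡pS : ∀ {n} {G : Graph n} → IsSimple G → ThreeSymmetric G → 3 ≤ n → ∀ {S} → IsSimple S → t S G ≡ pS S
t≡pS _ (inj₁ n<3) 3≤n = ⊥-elim (<⇒≱ n<3 3≤n)
t≡pS {G = G} sG (inj₂ (tK3 , tcoK3 , tP3 , tcoP3)) _ {S} sS =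
  trans (t-canonical sG sS) (trans on-canonical (sym (pS-canonical {S} sS)))
  where
  on-representatives : ∀ a b c → t (representative a b c) G ≡ pS (representative a b c)
  on-representatives true  true  true  = tK3
  on-representatives true  true  false = tP3
  on-representatives true  false true  = tP3
  on-representatives false true  true  = tP3
  on-representatives true  false false = tcoP3
  on-representatives false true  false = tcoP3
  on-representatives false false true  = tcoP3
  on-representatives false false false = tcoK3
  on-canonical : t (canonical S) G ≡ pS (canonical S)
  on-canonical = on-representatives (S 0F 1F) (S 0F 2F) (S 1F 2F)

-- Triples in a product of index sets

≺⇒< : ∀ {k} (a b : Fin k) → a ≺ b ≡ true → toℕ a < toℕ b
≺⇒< a b a≺b = <ᵇ⇒< (toℕ a) (toℕ b) (Equivalence.from T-≡ a≺b)

<⇒≺ : ∀ {k} (a b : Fin k) → toℕ a < toℕ b → a ≺ b ≡ true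
<⇒≺ a b a<b = Equivalence.to T-≡ (<⇒<ᵇ a<b)

⊀⇒≥ : ∀ {k} (a b : Fin k) → a ≺ b ≡ false → toℕ b ≤ toℕ a
⊀⇒≥ a b a⊀b = ≮⇒≥ λ a<b → case trans (sym (<⇒≺ a b a<b)) a⊀b of λ ()

increasing⇒< : ∀ {k} (a b c : Fin k) → increasing a b c ≡ true → toℕ a < toℕ b × toℕ b < toℕ c
increasing⇒< a b c h = ≺⇒< a b (∧-conicalˡ (a ≺ b) (b ≺ c) h) , ≺⇒< b c (∧-conicalʳ (a ≺ b) (b ≺ c) h)

∧-false : ∀ x y → x ∧ y ≡ false → x ≡ false ⊎ y ≡ false
∧-false false y _ = inj₁ refl
∧-false true  y h = inj₂ h

combine-monoˡ-≤⁻¹ : ∀ {n m} {u v : Fin n} (a b : Fin m) →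
                    toℕ (combine u a) < toℕ (combine v b) → toℕ u ≤ toℕ v
combine-monoˡ-≤⁻¹ a b X<Y = ≮⇒≥ λ v<u → <-asym X<Y (combine-monoˡ-< b a v<u)

𝟙-≟-refl : ∀ {k} (u : Fin k) → 𝟙 (does (u ≟ᶠ u)) ≡ 1
𝟙-≟-refl Fin.zero    = refl
𝟙-≟-refl (Fin.suc u) = 𝟙-≟-refl u

module _ {n m : ℕ} {u v w : Fin n} (a b c : Fin m) where

  increasing-combine : increasing u v w ≡ true → increasing (combine u a) (combine v b) (combine w c) ≡ true
  increasing-combine h = let u<v , v<w = increasing⇒< u v w h in
    cong₂ _∧_ (<⇒≺ (combine u a) (combine v b) (combine-monoˡ-< a b u<v))
              (<⇒≺ (combine v b) (combine w c) (combine-monoˡ-< b c v<w))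

  increasing-combine⁻¹ : increasing (combine u a) (combine v b) (combine w c) ≡ true →
                         increasing u v w ≡ false → u ≡ v ⊎ v ≡ w
  increasing-combine⁻¹ h h′
    with X<Y , Y<Z ← increasing⇒< (combine u a) (combine v b) (combine w c) h | ∧-false (u ≺ v) (v ≺ w) h′
  ... | inj₁ u⊀v = inj₁ (toℕ-injective (≤-antisym (combine-monoˡ-≤⁻¹ a b X<Y) (⊀⇒≥ u v u⊀v)))
  ... | inj₂ v⊀w = inj₂ (toℕ-injective (≤-antisym (combine-monoˡ-≤⁻¹ b c Y<Z) (⊀⇒≥ v w v⊀w)))

  collision : 𝟙 (increasing (combine u a) (combine v b) (combine w c) ∧ not (increasing u v w))
              ≤ 𝟙 (does (u ≟ᶠ v)) + 𝟙 (does (v ≟ᶠ w))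
  collision with increasing (combine u a) (combine v b) (combine w c) in W | increasing u v w in U
  ... | false | _    = z≤n
  ... | true  | true = z≤n
  ... | true  | false with increasing-combine⁻¹ W U
  ...   | inj₁ refl = ≤-trans (≤-reflexive (sym (𝟙-≟-refl u))) (m≤m+n _ _)
  ...   | inj₂ refl = ≤-trans (≤-reflexive (sym (𝟙-≟-refl v))) (m≤n+m _ _)

∑-𝟙-≟ : ∀ {k} (u : Fin k) → ∑[ v < k ] 𝟙 (does (u ≟ᶠ v)) ≡ 1
∑-𝟙-≟ {suc k} Fin.zero    = cong suc (sum-replicate-zero k)
∑-𝟙-≟ {suc k} (Fin.suc u) = ∑-𝟙-≟ u

#collisions : ∀ n → ∑³ n (λ u v w → 𝟙 (does (u ≟ᶠ v)) + 𝟙 (does (v ≟ᶠ w))) ≡ 2 * (n * n)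
#collisions n = begin
  ∑³ n (λ u v w → 𝟙 (does (u ≟ᶠ v)) + 𝟙 (does (v ≟ᶠ w)))
    ≡⟨ ∑³-distrib-+ {n} (λ u v w → 𝟙 (does (u ≟ᶠ v))) (λ u v w → 𝟙 (does (v ≟ᶠ w))) ⟩
  ∑³ n (λ u v w → 𝟙 (does (u ≟ᶠ v))) + ∑³ n (λ u v w → 𝟙 (does (v ≟ᶠ w)))
    ≡⟨ cong₂ _+_ (∑-cong {n} λ u → trans (∑-cong {n} λ v → ∑-const n (𝟙 (does (u ≟ᶠ v))))
                                        (trans (∑-*ˡ n (λ v → 𝟙 (does (u ≟ᶠ v)))) (cong (n *_) (∑-𝟙-≟ u))))
                 (∑-cong {n} λ u → ∑-cong {n} λ v → ∑-𝟙-≟ v) ⟩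
  ∑[ u < n ] (n * 1) + ∑[ u < n ] ∑[ v < n ] 1
    ≡⟨ cong₂ _+_ (∑-const n (n * 1)) (trans (∑-cong {n} λ _ → ∑-const n 1) (∑-const n (n * 1))) ⟩
  n * (n * 1) + n * (n * 1)
    ≡⟨ double n ⟩
  2 * (n * n) ∎
  where
  open ≡-Reasoning
  double : ∀ n → n * (n * 1) + n * (n * 1) ≡ 2 * (n * n)
  double = solve-∀

module _ (n m : ℕ) where

  pullback : (Fin (n * m) → Fin (n * m) → Fin (n * m) → Bool) →
             Fin n → Fin n → Fin n → Fin m → Fin m → Fin m → Bool
  pullback P u v w a b c = P (combine u a) (combine v b) (combine w c)

  defect : (Fin (n * m) → Fin (n * m) → Fin (n * m) → Bool) → ℕ
  defect P = ∑³ n λ u v w → ∑³ m λ a b c →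
    𝟙 ((pullback increasing u v w a b c ∧ not (increasing u v w)) ∧ pullback P u v w a b c)

  #increasing-combine : ∀ P Q → (∀ {u v w} a b c → increasing u v w ≡ true → pullback P u v w a b c ≡ Q u v w) →
    #increasing (n * m) P ≡ m * m * m * #increasing n Q + defect P
  #increasing-combine P Q P≡Q = begin
    #increasing (n * m) P
      ≡⟨ ∑³-combine n _ ⟩
    (∑³ n λ u v w → ∑³ m λ a b c → 𝟙 (pullback increasing u v w a b c ∧ pullback P u v w a b c))
      ≡⟨ ∑³-cong {n} (λ u v w → ∑³-cong {m} λ a b c → 𝟙-split (pullback P u v w a b c) (Q u v w)
           (increasing-combine {u = u} {v} {w} a b c) (P≡Q {u} {v} {w} a b c)) ⟩
    (∑³ n λ u v w → ∑³ m λ a b c → 𝟙 (increasing u v w ∧ Q u v w)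
      + 𝟙 ((pullback increasing u v w a b c ∧ not (increasing u v w)) ∧ pullback P u v w a b c))
      ≡⟨ ∑³-cong {n} (λ u v w → ∑³-distrib-+ {m} _ _) ⟩
    (∑³ n λ u v w → (∑³ m λ _ _ _ → 𝟙 (increasing u v w ∧ Q u v w)) + (∑³ m λ a b c →
      𝟙 ((pullback increasing u v w a b c ∧ not (increasing u v w)) ∧ pullback P u v w a b c)))
      ≡⟨ ∑³-distrib-+ {n} _ _ ⟩
    (∑³ n λ u v w → ∑³ m λ _ _ _ → 𝟙 (increasing u v w ∧ Q u v w)) + defect P
      ≡⟨ cong (_+ defect P) (∑³-∑³-const n m _) ⟩
    m * m * m * #increasing n Q + defect P ∎
    where open ≡-Reasoning

  defect-bound : ∀ P → defect P ≤ m * m * m * (2 * (n * n))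
  defect-bound P = begin
    defect P
      ≤⟨ ∑³-mono {n} (λ u v w → ∑³-mono {m} λ a b c → ≤-trans
           (𝟙-∧-≤ (pullback increasing u v w a b c ∧ not (increasing u v w)) (pullback P u v w a b c))
           (collision {u = u} {v} {w} a b c)) ⟩
    (∑³ n λ u v w → ∑³ m λ _ _ _ → 𝟙 (does (u ≟ᶠ v)) + 𝟙 (does (v ≟ᶠ w)))
      ≡⟨ ∑³-∑³-const n m _ ⟩
    m * m * m * ∑³ n (λ u v w → 𝟙 (does (u ≟ᶠ v)) + 𝟙 (does (v ≟ᶠ w)))
      ≡⟨ cong (m * m * m *_) (#collisions n) ⟩
    m * m * m * (2 * (n * n)) ∎
    where open ≤-Reasoning

module _ {n m : ℕ} (G : Graph n) (H : Graph m) where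

  inflate-combine : ∀ u v a b → inflate G H (combine u a) (combine v b) ≡ (⌊ u ≟ᶠ v ⌋ ∧ H a b) ∨ G u v
  inflate-combine u v a b
    rewrite cong proj₁ (remQuot-combine {n} {m} u a) | cong proj₁ (remQuot-combine {n} {m} v b)
          | cong proj₂ (remQuot-combine {n} {m} u a) | cong proj₂ (remQuot-combine {n} {m} v b) = refl

  inflate-combine-≢ : ∀ {u v} a b → ¬ u ≡ v → inflate G H (combine u a) (combine v b) ≡ G u v
  inflate-combine-≢ {u} {v} a b u≢v rewrite inflate-combine u v a b with u ≟ᶠ v
  ... | yes u≡v = ⊥-elim (u≢v u≡v)
  ... | no  _   = refl

  inflate-combine-diag : (∀ a → H a a ≡ false) → ∀ u a → inflate G H (combine u a) (combine u a) ≡ G u u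
  inflate-combine-diag H-irrefl u a rewrite inflate-combine u u a a | H-irrefl a with u ≟ᶠ u
  ... | yes _ = refl
  ... | no  _ = refl

  induced-inflate : (∀ a → H a a ≡ false) → ∀ {u v w : Fin n} (a b c : Fin m) → increasing u v w ≡ true →
    ∀ i j → induced (inflate G H) (combine u a , combine v b , combine w c) i j ≡ induced G (u , v , w) i j
  induced-inflate H-irrefl {u} {v} {w} a b c h = entries
    where
    u<v : toℕ u < toℕ v
    u<v = proj₁ (increasing⇒< u v w h)
    v<w : toℕ v < toℕ w
    v<w = proj₂ (increasing⇒< u v w h)
    u≢v : ¬ u ≡ v
    u≢v = <⇒≢ᶠ u<v
    v≢w : ¬ v ≡ w
    v≢w = <⇒≢ᶠ v<w
    u≢w : ¬ u ≡ w
    u≢w = <⇒≢ᶠ (<-trans u<v v<w)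
    entries : ∀ i j → induced (inflate G H) (combine u a , combine v b , combine w c) i j
                    ≡ induced G (u , v , w) i j
    entries 0F 0F = inflate-combine-diag H-irrefl u a
    entries 0F 1F = inflate-combine-≢ a b u≢v
    entries 0F 2F = inflate-combine-≢ a c u≢w
    entries 1F 0F = inflate-combine-≢ b a (≢-sym u≢v)
    entries 1F 1F = inflate-combine-diag H-irrefl v b
    entries 1F 2F = inflate-combine-≢ b c v≢w
    entries 2F 0F = inflate-combine-≢ c a (≢-sym u≢w)
    entries 2F 1F = inflate-combine-≢ c b (≢-sym v≢w)
    entries 2F 2F = inflate-combine-diag H-irrefl w c

-- Estimates

C2-poly : ∀ n → 2 * (n C 2) + n ≡ n * n
C2-poly zero    = refl
C2-poly (suc n) = begin
  2 * (suc n C 2) + suc n         ≡⟨ cong (λ x → 2 * x + suc n) (nCk+nC[k+1]≡[n+1]C[k+1] n 1) ⟨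
  2 * (n C 1 + n C 2) + suc n     ≡⟨ cong (λ x → 2 * (x + n C 2) + suc n) (nC1≡n n) ⟩
  2 * (n + n C 2) + suc n         ≡⟨ regroup n (n C 2) ⟩
  (2 * (n C 2) + n) + (2 * n + 1) ≡⟨ cong (_+ (2 * n + 1)) (C2-poly n) ⟩
  n * n + (2 * n + 1)             ≡⟨ square n ⟩
  suc n * suc n                   ∎
  where
  open ≡-Reasoning
  regroup : ∀ n c → 2 * (n + c) + suc n ≡ (2 * c + n) + (2 * n + 1)
  regroup = solve-∀
  square : ∀ n → n * n + (2 * n + 1) ≡ suc n * suc n
  square = solve-∀

C3-poly : ∀ n → 6 * (n C 3) + 3 * (n * n) ≡ n * (n * n) + 2 * n
C3-poly zero    = refl
C3-poly (suc n) = +-cancelʳ-≡ (3 * (n * n) + 3 * n) _ _ (begin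
  6 * (suc n C 3) + 3 * (suc n * suc n) + (3 * (n * n) + 3 * n)
    ≡⟨ cong (λ x → 6 * x + 3 * (suc n * suc n) + (3 * (n * n) + 3 * n)) (nCk+nC[k+1]≡[n+1]C[k+1] n 2) ⟨
  6 * (n C 2 + n C 3) + 3 * (suc n * suc n) + (3 * (n * n) + 3 * n)
    ≡⟨ regroup n (n C 2) (n C 3) ⟩
  (6 * (n C 3) + 3 * (n * n)) + 3 * (2 * (n C 2) + n) + 3 * (suc n * suc n)
    ≡⟨ cong₂ (λ x y → x + 3 * y + 3 * (suc n * suc n)) (C3-poly n) (C2-poly n) ⟩
  (n * (n * n) + 2 * n) + 3 * (n * n) + 3 * (suc n * suc n)
    ≡⟨ cube n ⟩
  suc n * (suc n * suc n) + 2 * suc n + (3 * (n * n) + 3 * n) ∎)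
  where
  open ≡-Reasoning
  regroup : ∀ n c₂ c₃ → 6 * (c₂ + c₃) + 3 * (suc n * suc n) + (3 * (n * n) + 3 * n)
                      ≡ (6 * c₃ + 3 * (n * n)) + 3 * (2 * c₂ + n) + 3 * (suc n * suc n)
  regroup = solve-∀
  cube : ∀ n → (n * (n * n) + 2 * n) + 3 * (n * n) + 3 * (suc n * suc n)
             ≡ suc n * (suc n * suc n) + 2 * suc n + (3 * (n * n) + 3 * n)
  cube = solve-∀

2n²q<nC3 : ∀ q n → 12 * q + 3 ≤ n → 2 * (n * n) * q < n C 3
2n²q<nC3 q n 12q+3≤n = *-cancelˡ-< 6 _ _ (+-cancelʳ-< (3 * (n * n)) _ _ (begin-strict
  6 * (2 * (n * n) * q) + 3 * (n * n) ≡⟨ expand q n ⟩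
  (12 * q + 3) * (n * n)              ≤⟨ *-monoˡ-≤ (n * n) 12q+3≤n ⟩
  n * (n * n)                         <⟨ m<m+n (n * (n * n)) 0<2n ⟩
  n * (n * n) + 2 * n                 ≡⟨ C3-poly n ⟨
  6 * (n C 3) + 3 * (n * n)           ∎))
  where
  open ≤-Reasoning
  expand : ∀ q n → 6 * (2 * (n * n) * q) + 3 * (n * n) ≡ (12 * q + 3) * (n * n)
  expand = solve-∀
  0<2n : 0 < 2 * n
  0<2n = <-≤-trans z<s (≤-trans (≤-trans (m≤n+m 3 (12 * q)) 12q+3≤n) (m≤n*m n 2))

module _ where

  open import Data.Integer using (+_)

  ∣⊖∣≤ : ∀ x y B → x ≤ y + B → y ≤ x + B → ℤ.∣ x ⊖ y ∣ ≤ B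
  ∣⊖∣≤ x y B x≤y+B y≤x+B with ≤-total y x
  ... | inj₁ y≤x rewrite ℤ.⊖-≥ y≤x = m≤n+o⇒m∸n≤o x y x≤y+B
  ... | inj₂ x≤y rewrite ℤ.⊖-≤ x≤y | ℤ.∣-i∣≡∣i∣ (+ (y ∸ x)) = m≤n+o⇒m∸n≤o y x y≤x+B

  -- The numerator of ε is at least 1, so ε ≥ 1 / ↧ε and it suffices that
  -- ∣ A K - c N ∣ ↧ε < N K.
  frac-close : ∀ {A c N K} B (ε : ℚ) → ℚ.0ℚ ℚ.< ε →
    A * K ≤ c * N + B * K → c * N ≤ A * K + B * K → B * ℚ.↧ₙ ε < N → 0 < K →
    ℚ.∣ frac A N ℚ.- frac c K ∣ ℚ.< ε
  frac-close {A} {c} {suc N′} {suc K′} B (mkℚ +[1+ k ] q′ _) _ AK≤ cN≤ Bq<N _ =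
    ℚ.toℚᵘ-cancel-< (ℚᵘ.<-respˡ-≃ (ℚᵘ.≃-sym as-unnormalised) (ℚᵘ.*<* cross-multiplied))
    where
    N K q : ℕ
    N = suc N′
    K = suc K′
    q = suc q′
    as-unnormalised : ℚ.toℚᵘ (ℚ.∣ frac A N ℚ.- frac c K ∣) ℚᵘ.≃ ℚᵘ.∣ mkℚᵘ (+ A) N′ ℚᵘ.- mkℚᵘ (+ c) K′ ∣
    as-unnormalised = ℚᵘ.≃-trans (ℚ.toℚᵘ-homo-∣-∣ (frac A N ℚ.- frac c K)) (ℚᵘ.∣-∣-cong
      (ℚᵘ.≃-trans (ℚ.toℚᵘ-homo-+ (frac A N) (ℚ.- frac c K)) (ℚᵘ.+-cong (ℚ.toℚᵘ-fromℚᵘ (mkℚᵘ (+ A) N′))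
        (ℚᵘ.≃-trans (ℚ.toℚᵘ-homo‿- (frac c K)) (ℚᵘ.-‿cong (ℚ.toℚᵘ-fromℚᵘ (mkℚᵘ (+ c) K′)))))))
    numerator : (+ A) ℤ.* (+ K) ℤ.+ (ℤ.- (+ c)) ℤ.* (+ N) ≡ (A * K) ⊖ (c * N)
    numerator = begin
      (+ A) ℤ.* (+ K) ℤ.+ (ℤ.- (+ c)) ℤ.* (+ N) ≡⟨ cong₂ ℤ._+_ (ℤ.pos-* A K) (ℤ.neg-distribˡ-* (+ c) (+ N)) ⟨
      + (A * K) ℤ.+ ℤ.- ((+ c) ℤ.* (+ N))       ≡⟨ cong (λ z → + (A * K) ℤ.+ ℤ.- z) (ℤ.pos-* c N) ⟨
      + (A * K) ℤ.+ ℤ.- (+ (c * N))             ≡⟨ ℤ.m-n≡m⊖n (A * K) (c * N) ⟩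
      (A * K) ⊖ (c * N)                         ∎
      where open ≡-Reasoning
    bound : ℤ.∣ (A * K) ⊖ (c * N) ∣ * q < suc k * (N * K)
    bound = begin-strict
      ℤ.∣ (A * K) ⊖ (c * N) ∣ * q ≤⟨ *-monoˡ-≤ q (∣⊖∣≤ _ _ _ AK≤ cN≤) ⟩
      B * K * q                   ≡⟨ swap B K q ⟩
      B * q * K                   <⟨ *-monoˡ-< K Bq<N ⟩
      N * K                       ≤⟨ m≤m+n (N * K) _ ⟩
      suc k * (N * K)             ∎
      where
      open ≤-Reasoning
      swap : ∀ B K q → B * K * q ≡ B * q * K
      swap = solve-∀
    cross-multiplied : (+ ℤ.∣ (+ A) ℤ.* (+ K) ℤ.+ (ℤ.- (+ c)) ℤ.* (+ N) ∣) ℤ.* (+ q) ℤ.< +[1+ k ] ℤ.* (+ (N * K))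
    cross-multiplied rewrite numerator =
      subst₂ ℤ._<_ (ℤ.pos-* ℤ.∣ (A * K) ⊖ (c * N) ∣ q) (ℤ.pos-* (suc k) (N * K)) (ℤ.+<+ bound)
  frac-close _ (mkℚ (+ zero) _ _) (ℚ.*<* (ℤ.+<+ ())) _ _ _ _
  frac-close _ (mkℚ -[1+ _ ] _ _) (ℚ.*<* ()) _ _ _ _

cross-bounds : ∀ {y z c K Dₐ D B} → y * K ≡ c * z → Dₐ ≤ B → D ≤ B → c ≤ K →
  (y + Dₐ) * K ≤ c * (z + D) + B * K × c * (z + D) ≤ (y + Dₐ) * K + B * K
cross-bounds {y} {z} {c} {K} {Dₐ} {D} {B} yK≡cz Dₐ≤B D≤B c≤K = upper , lower
  where
  open ≤-Reasoning
  upper : (y + Dₐ) * K ≤ c * (z + D) + B * K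
  upper = begin
    (y + Dₐ) * K        ≡⟨ *-distribʳ-+ K y Dₐ ⟩
    y * K + Dₐ * K      ≡⟨ cong (_+ Dₐ * K) yK≡cz ⟩
    c * z + Dₐ * K      ≤⟨ +-mono-≤ (*-monoʳ-≤ c (m≤m+n z D)) (*-monoˡ-≤ K Dₐ≤B) ⟩
    c * (z + D) + B * K ∎
  lower : c * (z + D) ≤ (y + Dₐ) * K + B * K
  lower = begin
    c * (z + D)          ≡⟨ *-distribˡ-+ c z D ⟩
    c * z + c * D        ≡⟨ cong (_+ c * D) yK≡cz ⟨
    y * K + c * D        ≤⟨ +-mono-≤ (*-monoˡ-≤ K (m≤m+n y Dₐ)) (*-mono-≤ c≤K D≤B) ⟩
    (y + Dₐ) * K + K * B ≡⟨ cong ((y + Dₐ) * K +_) (*-comm K B) ⟩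
    (y + Dₐ) * K + B * K ∎

perturbed-ratio-close : ∀ {x c K Dₐ D E} (ε : ℚ) → ℚ.0ℚ ℚ.< ε → 0 < x → c ≤ K →
  Dₐ ≤ x * E → D ≤ x * E → E * ℚ.↧ₙ ε < K →
  ℚ.∣ frac (x * c + Dₐ) (x * K + D) ℚ.- frac c K ∣ ℚ.< ε
perturbed-ratio-close {x} {c} {K} {Dₐ} {D} {E} ε ε>0 0<x c≤K Dₐ≤xE D≤xE Eq<K =
  frac-close {x * c + Dₐ} {c} {x * K + D} {K} (x * E) ε ε>0
    (proj₁ cross) (proj₂ cross) xEq<N (≤-<-trans z≤n Eq<K)
  where
  q : ℕ
  q = ℚ.↧ₙ ε
  cross : (x * c + Dₐ) * K ≤ c * (x * K + D) + x * E * K × c * (x * K + D) ≤ (x * c + Dₐ) * K + x * E * K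
  cross = cross-bounds {x * c} {x * K} (commute x c K) Dₐ≤xE D≤xE c≤K
    where
    commute : ∀ x c K → x * c * K ≡ c * (x * K)
    commute = solve-∀
  xEq<N : x * E * q < x * K + D
  xEq<N = begin-strict
    x * E * q     ≡⟨ *-assoc x E q ⟩
    x * (E * q)   <⟨ *-monoʳ-< x {{>-nonZero 0<x}} Eq<K ⟩
    x * K         ≤⟨ m≤m+n (x * K) D ⟩
    x * K + D     ∎
    where open ≤-Reasoning

inflate-close : ∀ {n m} (G : Graph n) (H : Graph (suc m)) → (∀ a → H a a ≡ false) →
  ∀ S (ε : ℚ) → ℚ.0ℚ ℚ.< ε → 12 * ℚ.↧ₙ ε + 3 ≤ n → ℚ.∣ t S (inflate G H) ℚ.- t S G ∣ ℚ.< ε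
inflate-close {n} {m′} G H H-irrefl S ε ε>0 n-large =
  subst₂ (λ x y → ℚ.∣ x ℚ.- y ∣ ℚ.< ε) (sym inflated-ratio) (sym (t≡#increasing-ratio G S)) ratios-close
  where
  m : ℕ
  m = suc m′
  all : ∀ {k} → Fin k → Fin k → Fin k → Bool
  all _ _ _ = true
  P : Fin (n * m) → Fin (n * m) → Fin (n * m) → Bool
  P x y z = iso3 (induced (inflate G H) (x , y , z)) S
  Q : Fin n → Fin n → Fin n → Bool
  Q u v w = iso3 (induced G (u , v , w)) S
  inflated-ratio : t S (inflate G H) ≡ frac (m * m * m * #increasing n Q + defect n m P)
                                            (m * m * m * #increasing n all + defect n m all)
  inflated-ratio = trans (t≡#increasing-ratio (inflate G H) S) (cong₂ frac
    (#increasing-combine n m P Q λ a b c h → iso3-congˡ S (induced-inflate G H H-irrefl a b c h))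
    (#increasing-combine n m all all λ _ _ _ _ → refl))
  2n²q<K : 2 * (n * n) * ℚ.↧ₙ ε < #increasing n all
  2n²q<K = subst (2 * (n * n) * ℚ.↧ₙ ε <_) (sym (#increasing-all n)) (2n²q<nC3 (ℚ.↧ₙ ε) n n-large)
  ratios-close : ℚ.∣ frac (m * m * m * #increasing n Q + defect n m P) (m * m * m * #increasing n all + defect n m all)
                   ℚ.- frac (#increasing n Q) (#increasing n all) ∣ ℚ.< ε
  ratios-close = perturbed-ratio-close {m * m * m} {E = 2 * (n * n)} ε ε>0 z<s
    (#increasing-≤-all n Q) (defect-bound n m P) (defect-bound n m all) 2n²q<K

mainTheorem5 : (m : ℕ) (H₀ : Graph m) → IsSimple H₀ → ThreeSymmetric H₀ → 1 ≤ m
    → (size : ℕ → ℕ) (G : (i : ℕ) → Graph (size i))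
    → (∀ i → IsSimple (G i)) → (∀ i → ThreeSymmetric (G i))
    → TendsToInfinity size
    → (S : Graph 3) → IsSimple S
    → ConvergesTo (λ i → t S (inflate (G i) H₀)) (pS S)
mainTheorem5 zero    _  _   _ ()
mainTheorem5 (suc m) H₀ sH₀ _ _ size G sG symG size→∞ S sS ε ε>0 = N₀ , λ i N₀≤i →
  subst (λ p → ℚ.∣ t S (inflate (G i) H₀) ℚ.- p ∣ ℚ.< ε)
    (t≡pS (sG i) (symG i) (≤-trans (m≤n+m 3 (12 * ℚ.↧ₙ ε)) (large i N₀≤i)) sS)
    (inflate-close (G i) H₀ (IsSimple.irrefl sH₀) S ε ε>0 (large i N₀≤i))
  where
  N₀ : ℕ
  N₀ = proj₁ (size→∞ (12 * ℚ.↧ₙ ε + 3))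
  large : ∀ i → N₀ ≤ i → 12 * ℚ.↧ₙ ε + 3 ≤ size i
  large = proj₂ (size→∞ (12 * ℚ.↧ₙ ε + 3))
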